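{- On $\mathcal H_K$, the adjoint of $P$ with respect to the inner product $(\cdot,\cdot)$ is $N+M_\bullet$, where $M_\bullet$ is the operator $u\mapsto\bullet u$; equivalently, the adjoint of $N$ is $P-\frac{\partial}{\partial\bullet}$.
   Context: A rooted tree is a finite partially ordered set (elements called vertices) with a unique greatest element, the root, such that for every vertex $v$ the set of vertices greater than $v$ is a chain; if $v$ covers $w$, $w$ is a child of $v$. We regard it as a directed graph with edges from each vertex to its children; a vertex is terminal if it has no children. Rooted trees are considered up to isomorphism; $|t|$ is the number of vertices, $\bullet$ the one-vertex tree. Write $t\lhd t'$ if $t$ is obtained from $t'$ by deleting one terminal non-root vertex and the edge into it. For $t\lhd t'$, $n(t;t')$ is the number of vertices of $t$ at which attaching a new edge to a new terminal vertex yields $t'$, and $m(t;t')$ is the number of edges of $t'$ whose removal (with their terminal endpoint) leaves $t$. For a vertex $v$ of $t$, $t_v$ is the rooted tree of $v$ and its descendants; if $v$ has children $v_1,\dots,v_k$, $SG(t,v)$ is the group generated by the exchanges of $t_{v_i}$ with $t_{v_j}$ whenever isomorphic; $SG(t)=\prod_vSG(t,v)$. Let $k$ be a field of characteristic $0$, $k\{\mathcal T\}$ the vector space with basis the rooted trees, with inner product $(t,t')=|SG(t)|\delta_{t,t'}$ and linear operators $\mathfrak N(t)=\sum_{t\lhd t'}n(t;t')t'$, $\mathfrak P(t)=\sum_{t'\lhd t}m(t';t)t'$ for $t\ne\bullet$, $\mathfrak P(\bullet)=0$. $\mathcal H_K$ is the polynomial algebra over $k$ generated by the rooted trees. $B_+:\mathcal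 H_K\to k\{\mathcal T\}$ is the linear map sending a monomial $t_1\cdots t_n$ to the tree obtained by adding a new root joined by new edges to the roots of $t_1,\dots,t_n$, with $B_+(1)=\bullet$ (a linear isomorphism). The inner product on $\mathcal H_K$ is $(u_1,u_2)=(B_+(u_1),B_+(u_2))$ for monomials $u_1,u_2$, extended bilinearly. $N$ is the derivation of $\mathcal H_K$ with $N(t)=\mathfrak N(t)$ for rooted trees $t$; $P$ is the derivation with $P(t)=\mathfrak P(t)$ for $|t|\ge2$ and $P(\bullet)=1$. $\frac{\partial}{\partial\bullet}$ is partial differentiation of polynomials with respect to the generator $\bullet$. -}

module Defs where

open import Level using (Level; _⊔_; suc)
open import Data.Nat as ℕ using (ℕ; zero) renaming (suc to 1+)
open import Data.Bool using (Bool; true; false; if_then_else_; _∧_)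
open import Data.List using (List; []; _∷_; map; _++_; concatMap)
open import Data.Maybe using (Maybe; just; nothing)
open import Data.Product using (Σ; _×_; _,_)
open import Relation.Nullary using (¬_)
open import Algebra.Bundles using (CommutativeRing)

record Field (c ℓ : Level) : Set (Level.suc (c ⊔ ℓ)) where
  field
    commutativeRing : CommutativeRing c ℓ
  open CommutativeRing commutativeRing public
  field
    1≉0     : ¬ (1# ≈ 0#)
    inverse : ∀ x → ¬ (x ≈ 0#) → Σ Carrier (λ y → x * y ≈ 1#)

  ⌜_⌝ : ℕ → Carrier
  ⌜ zero ⌝ = 0#
  ⌜ 1+ n ⌝ = 1# + ⌜ n ⌝

CharZero : ∀ {c ℓ} → Field c ℓ → Set ℓ
CharZero F = ∀ n → ¬ (⌜ 1+ n ⌝ ≈ 0#)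
  where open Field F

-- The order of children is immaterial; rooted trees up to
-- isomorphism are handled through the decision procedure _≅ᵇ_ below.

data Tree : Set where
  node : List Tree → Tree

• : Tree
• = node []

mutual
  _≅ᵇ_ : Tree → Tree → Bool
  node cs ≅ᵇ node ds = isoL cs ds

  isoL : List Tree → List Tree → Bool
  isoL []       []       = true
  isoL []       (_ ∷ _)  = false
  isoL (c ∷ cs) ds with removeIso c ds
  ... | just ds′ = isoL cs ds′
  ... | nothing  = false

  removeIso : Tree → List Tree → Maybe (List Tree)
  removeIso c []       = nothing
  removeIso c (d ∷ ds) with c ≅ᵇ d
  ... | true  = just ds
  ... | false with removeIso c ds
  ...   | just ds′ = just (d ∷ ds′)
  ...   | nothing  = nothing

countIso : Tree → List Tree → ℕ
countIso c []       = 0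
countIso c (d ∷ ds) = if c ≅ᵇ d then 1+ (countIso c ds) else countIso c ds

-- |SG(t,v)| for a vertex whose children carry the subtrees in the list:
-- the product over isomorphism classes of (multiplicity)!, computed as
-- the product over positions i of (1 + #{ j > i : t_j ≅ t_i }).
sgLocal : List Tree → ℕ
sgLocal []       = 1
sgLocal (c ∷ cs) = 1+ (countIso c cs) ℕ.* sgLocal cs

mutual
  ∣SG∣ : Tree → ℕ
  ∣SG∣ (node cs) = sgLocal cs ℕ.* ∣SG∣L cs

  ∣SG∣L : List Tree → ℕ
  ∣SG∣L []       = 1
  ∣SG∣L (c ∷ cs) = ∣SG∣ c ℕ.* ∣SG∣L cs

mutual
  -- one entry for every vertex v of t: the tree obtained from t by
  -- attaching a new edge at v to a new terminal vertex.
  -- (So t′ occurs exactly n(t;t′) times.)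
  grafts : Tree → List Tree
  grafts (node cs) = node (• ∷ cs) ∷ map node (graftsL cs)

  graftsL : List Tree → List (List Tree)
  graftsL []       = []
  graftsL (c ∷ cs) = map (_∷ cs) (grafts c) ++ map (c ∷_) (graftsL cs)

mutual
  -- one entry for every edge of t into a terminal vertex: the tree
  -- obtained by deleting that edge and that vertex.
  -- (So t′ occurs exactly m(t′;t) times.)
  prunes : Tree → List Tree
  prunes (node cs) = map node (prunesL cs)

  prunesL : List Tree → List (List Tree)
  prunesL []       = []
  prunesL (node [] ∷ cs)       = cs ∷ map (node [] ∷_) (prunesL cs)
  prunesL (node (d ∷ ds) ∷ cs) =
    map (_∷ cs) (prunes (node (d ∷ ds))) ++ map (node (d ∷ ds) ∷_) (prunesL cs)

module HK {c ℓ} (F : Field c ℓ) where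
  open Field F

  -- a monomial t₁⋯tₙ (order of factors immaterial)
  Monomial : Set
  Monomial = List Tree

  Poly : Set c
  Poly = List (Carrier × Monomial)

  B₊ : Monomial → Tree
  B₊ u = node u

  ⟪_,_⟫ᵀ : Tree → Tree → Carrier
  ⟪ t , t′ ⟫ᵀ = if t ≅ᵇ t′ then ⌜ ∣SG∣ t ⌝ else 0#

  ⟪_,_⟫ : Poly → Poly → Carrier
  ⟪ [] , q ⟫ = 0#
  ⟪ (a , u) ∷ p , q ⟫ = inner q + ⟪ p , q ⟫
    where
    inner : Poly → Carrier
    inner []             = 0#
    inner ((b , v) ∷ q′) = (a * b) * ⟪ B₊ u , B₊ v ⟫ᵀ + inner q′

  scale : Carrier → Poly → Poly
  scale a = map (λ { (b , u) → (a * b , u) })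

  _⊕_ : Poly → Poly → Poly
  p ⊕ q = p ++ q

  _⊖_ : Poly → Poly → Poly
  p ⊖ q = p ++ scale (- 1#) q

  gen : Tree → Poly
  gen t = (1# , t ∷ []) ∷ []

  mulMon : Poly → Monomial → Poly
  mulMon p w = map (λ { (b , u) → (b , u ++ w) }) p

  derivMon : (Tree → Poly) → Monomial → Poly
  derivMon D []      = []
  derivMon D (t ∷ u) = mulMon (D t) u ⊕ mulMon (derivMon D u) (t ∷ [])

  derivation : (Tree → Poly) → Poly → Poly
  derivation D []            = []
  derivation D ((a , u) ∷ p) = scale a (derivMon D u) ⊕ derivation D p

  𝔑 : Tree → Poly
  𝔑 t = map (λ t′ → (1# , t′ ∷ [])) (grafts t)

  𝔓 : Tree → Poly
  𝔓 t = map (λ t′ → (1# , t′ ∷ [])) (prunes t)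

  N : Poly → Poly
  N = derivation 𝔑

  P : Poly → Poly
  P = derivation Pgen
    where
    Pgen : Tree → Poly
    Pgen (node [])      = (1# , []) ∷ []
    Pgen (node (d ∷ ds)) = 𝔓 (node (d ∷ ds))

  ∂• : Poly → Poly
  ∂• = derivation ∂gen
    where
    ∂gen : Tree → Poly
    ∂gen (node [])      = (1# , []) ∷ []
    ∂gen (node (_ ∷ _)) = []

  M• : Poly → Poly
  M• = map (λ { (b , u) → (b , • ∷ u) })

  AdjointP : Set (c ⊔ ℓ)
  AdjointP = ∀ u v → ⟪ P u , v ⟫ ≈ ⟪ u , N v ⊕ M• v ⟫

  AdjointN : Set (c ⊔ ℓ)
  AdjointN = ∀ u v → ⟪ N u , v ⟫ ≈ ⟪ u , P v ⊖ ∂• v ⟫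

-- The pairing ⟪B₊u, B₊v⟫ = |SG(B₊u)| δ counts the isomorphisms B₊u ≅ B₊v.  Since P, N and ∂/∂•
-- are derivations, expanding bilinearly reduces everything to identities between such counts for
-- monomials u, v.  For P this is double counting: a leaf of B₊u together with an isomorphism from
-- B₊u with that leaf removed onto B₊v amounts to a vertex of B₊v together with an isomorphism from
-- B₊u onto B₊v with a new leaf grafted at that vertex.  Grafting at the root of B₊v gives B₊(•v),
-- the M• term; the other vertices lie in the factors of v and give N.  Counting only the leaves
-- attached to the root shows that ∂/∂• is adjoint to M•, and as ⟪_,_⟫ is symmetric the statement
-- for N follows from the one for P.

module Submission where

open import Level using (Level)
open import Algebra.Bundles using (CommutativeSemiring)
open import Function using (_∘_)
open import Data.List using (List; []; _∷_; map; _++_; [_])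
open import Data.List.Membership.Propositional using (_∈_)
open import Data.List.Membership.Propositional.Properties using (∈-map⁻)
open import Data.List.Relation.Unary.Any using (here; there)
open import Data.List.Relation.Binary.Permutation.Propositional as ↭ using (_↭_)
open import Data.Product using (_×_; _,_; proj₁; map₂)
import Relation.Binary.PropositionalEquality as ≡
open ≡ using (_≡_)
open import Defs

picks : ∀ {a} {A : Set a} → List A → List (A × List A)
picks []       = []
picks (x ∷ xs) = (x , xs) ∷ map (map₂ (x ∷_)) (picks xs)

picks-↭ : ∀ {a} {A : Set a} {xs : List A} {y ys} → (y , ys) ∈ picks xs → xs ↭ y ∷ ys
picks-↭ {xs = x ∷ xs} (here ≡.refl) = ↭.refl
picks-↭ {xs = x ∷ xs} (there p) with ∈-map⁻ (map₂ (x ∷_)) p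
... | (y , ys) , q , ≡.refl = ↭.trans (↭.prep x (picks-↭ q)) (↭.swap x y ↭.refl)

module ListSum {c ℓ} (S : CommutativeSemiring c ℓ) where

  open CommutativeSemiring S
  open import Algebra.Properties.CommutativeSemigroup +-commutativeSemigroup
    using (interchange; x∙yz≈y∙xz)
  open import Algebra.Properties.CommutativeSemigroup *-commutativeSemigroup
    using () renaming (x∙yz≈y∙xz to x*yz≈y*xz)
  open import Relation.Binary.Reasoning.Setoid setoid

  private variable
    a b : Level
    A : Set a
    B : Set b

  ∑ : List A → (A → Carrier) → Carrier
  ∑ []       f = 0#
  ∑ (x ∷ xs) f = f x + ∑ xs f

  ∑-cong-∈ : ∀ (xs : List A) {f g : A → Carrier} →
             (∀ {x} → x ∈ xs → f x ≈ g x) → ∑ xs f ≈ ∑ xs g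
  ∑-cong-∈ []       f≈g = refl
  ∑-cong-∈ (x ∷ xs) f≈g = +-cong (f≈g (here ≡.refl)) (∑-cong-∈ xs (f≈g ∘ there))

  ∑-cong : ∀ (xs : List A) {f g : A → Carrier} → (∀ x → f x ≈ g x) → ∑ xs f ≈ ∑ xs g
  ∑-cong xs f≈g = ∑-cong-∈ xs (λ {x} _ → f≈g x)

  ∑-map : (h : B → A) (xs : List B) (f : A → Carrier) → ∑ (map h xs) f ≡ ∑ xs (f ∘ h)
  ∑-map h []       f = ≡.refl
  ∑-map h (x ∷ xs) f = ≡.cong (f (h x) +_) (∑-map h xs f)

  ∑-++ : ∀ (xs ys : List A) (f : A → Carrier) → ∑ (xs ++ ys) f ≈ ∑ xs f + ∑ ys f
  ∑-++ []       ys f = sym (+-identityˡ _)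
  ∑-++ (x ∷ xs) ys f = trans (+-congˡ (∑-++ xs ys f)) (sym (+-assoc (f x) _ _))

  ∑-zero : ∀ (xs : List A) → ∑ xs (λ _ → 0#) ≈ 0#
  ∑-zero []       = refl
  ∑-zero (x ∷ xs) = trans (+-identityˡ _) (∑-zero xs)

  ∑-↭ : ∀ {xs ys : List A} → xs ↭ ys → (f : A → Carrier) → ∑ xs f ≈ ∑ ys f
  ∑-↭ ↭.refl         f = refl
  ∑-↭ (↭.prep x p)   f = +-congˡ (∑-↭ p f)
  ∑-↭ (↭.swap x y p) f = trans (x∙yz≈y∙xz (f x) (f y) _) (+-congˡ (+-congˡ (∑-↭ p f)))
  ∑-↭ (↭.trans p p′) f = trans (∑-↭ p f) (∑-↭ p′ f)

  ∑-distrib-+ : ∀ (xs : List A) (f g : A → Carrier) → ∑ xs (λ x → f x + g x) ≈ ∑ xs f + ∑ xs g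
  ∑-distrib-+ []       f g = sym (+-identityˡ 0#)
  ∑-distrib-+ (x ∷ xs) f g = trans (+-congˡ (∑-distrib-+ xs f g)) (interchange (f x) (g x) _ _)

  ∑-distribˡ : ∀ k (xs : List A) (f : A → Carrier) → k * ∑ xs f ≈ ∑ xs (λ x → k * f x)
  ∑-distribˡ k []       f = zeroʳ k
  ∑-distribˡ k (x ∷ xs) f = trans (distribˡ k (f x) _) (+-congˡ (∑-distribˡ k xs f))

  ∑-distribʳ : ∀ k (xs : List A) (f : A → Carrier) → ∑ xs f * k ≈ ∑ xs (λ x → f x * k)
  ∑-distribʳ k xs f =
    trans (*-comm _ k) (trans (∑-distribˡ k xs f) (∑-cong xs (λ x → *-comm k (f x))))

  ∑-comm : (xs : List A) (ys : List B) (f : A → B → Carrier) →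
           ∑ xs (λ x → ∑ ys (f x)) ≈ ∑ ys (λ y → ∑ xs (λ x → f x y))
  ∑-comm []       ys f = sym (∑-zero ys)
  ∑-comm (x ∷ xs) ys f = trans (+-congˡ (∑-comm xs ys f)) (sym (∑-distrib-+ ys (f x) _))

  ∑-*-comm : ∀ (xs : List A) (ys : List B) (f : A → Carrier) (g : B → Carrier) (h : A → B → Carrier) →
             ∑ xs (λ x → f x * ∑ ys (λ y → g y * h x y)) ≈
             ∑ ys (λ y → g y * ∑ xs (λ x → f x * h x y))
  ∑-*-comm xs ys f g h = begin
      ∑ xs (λ x → f x * ∑ ys (λ y → g y * h x y))
    ≈⟨ ∑-cong xs (λ x → ∑-distribˡ (f x) ys _) ⟩
      ∑ xs (λ x → ∑ ys (λ y → f x * (g y * h x y)))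
    ≈⟨ ∑-comm xs ys _ ⟩
      ∑ ys (λ y → ∑ xs (λ x → f x * (g y * h x y)))
    ≈⟨ ∑-cong ys (λ y → ∑-cong xs (λ x → x*yz≈y*xz (f x) (g y) _)) ⟩
      ∑ ys (λ y → ∑ xs (λ x → g y * (f x * h x y)))
    ≈⟨ ∑-cong ys (λ y → ∑-distribˡ (g y) xs _) ⟨
      ∑ ys (λ y → g y * ∑ xs (λ x → f x * h x y))
    ∎

  ∑-picks-∷ : ∀ (x : A) xs (f : A × List A → Carrier) →
              ∑ (picks (x ∷ xs)) f ≡ f (x , xs) + ∑ (picks xs) (λ (y , ys) → f (y , x ∷ ys))
  ∑-picks-∷ x xs f = ≡.cong (f (x , xs) +_) (∑-map (map₂ (x ∷_)) (picks xs) f)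

  ∑-picks-proj₁ : ∀ (xs : List A) (f : A → Carrier) → ∑ (picks xs) (f ∘ proj₁) ≡ ∑ xs f
  ∑-picks-proj₁ []       f = ≡.refl
  ∑-picks-proj₁ (x ∷ xs) f = ≡.trans (∑-picks-∷ x xs _) (≡.cong (f x +_) (∑-picks-proj₁ xs f))

  ∑-picks-swap : ∀ (xs : List A) (F : A → A → List A → Carrier) →
                 ∑ (picks xs) (λ (x , ys) → ∑ (picks ys) (λ (y , zs) → F x y zs)) ≈
                 ∑ (picks xs) (λ (x , ys) → ∑ (picks ys) (λ (y , zs) → F y x zs))
  ∑-picks-swap []       F = refl
  ∑-picks-swap {A = A} (x ∷ xs) F = begin
      ∑ (picks (x ∷ xs)) (λ (y , ys) → ∑ (picks ys) (λ (z , zs) → F y z zs))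
    ≈⟨ expand F ⟩
      ∑ (picks xs) (λ (y , ys) → F x y ys) + (∑ (picks xs) (λ (y , ys) → F y x ys) + _)
    ≈⟨ +-congˡ (+-congˡ (∑-picks-swap xs (λ y z zs → F y z (x ∷ zs)))) ⟩
      ∑ (picks xs) (λ (y , ys) → F x y ys) + (∑ (picks xs) (λ (y , ys) → F y x ys) + _)
    ≈⟨ x∙yz≈y∙xz _ _ _ ⟩
      ∑ (picks xs) (λ (y , ys) → F y x ys) + (∑ (picks xs) (λ (y , ys) → F x y ys) + _)
    ≈⟨ expand (λ y z zs → F z y zs) ⟨
      ∑ (picks (x ∷ xs)) (λ (y , ys) → ∑ (picks ys) (λ (z , zs) → F z y zs))
    ∎
    where
    expand : ∀ (G : A → A → List A → Carrier) →
             ∑ (picks (x ∷ xs)) (λ (y , ys) → ∑ (picks ys) (λ (z , zs) → G y z zs)) ≈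
             ∑ (picks xs) (λ (y , ys) → G x y ys) +
             (∑ (picks xs) (λ (y , ys) → G y x ys) +
              ∑ (picks xs) (λ (y , ys) → ∑ (picks ys) (λ (z , zs) → G y z (x ∷ zs))))
    expand G = trans (reflexive (∑-picks-∷ x xs _)) (+-congˡ (trans
      (∑-cong (picks xs) (λ (y , ys) → reflexive (∑-picks-∷ x ys _)))
      (∑-distrib-+ (picks xs) _ _)))

module Isomorphisms where

  open import Data.Nat using (ℕ; suc; _+_; _*_)
  open import Data.Nat.Properties
  open import Data.Nat.Solver using (module +-*-Solver)
  open +-*-Solver using (solve; _:+_; _:*_; _:=_; con)
  open import Data.Bool using (Bool; true; false; if_then_else_)
  open import Data.Bool.Properties using (⇔→≡)
  open import Data.Maybe using (just; nothing)
  open import Data.Product using (∃-syntax)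
  open import Function using (_⇔_; mk⇔)
  import Function.Properties.Equivalence as ⇔
  open import Data.List.Relation.Unary.All using (All; []; _∷_)
  open import Data.List.Relation.Binary.Permutation.Propositional using (refl; prep; swap; trans)
  open import Data.List.Relation.Binary.Permutation.Propositional.Properties using (All-resp-↭)
  open import Algebra.Properties.CommutativeSemigroup *-commutativeSemigroup using (x∙yz≈y∙xz)
  open import Relation.Binary.PropositionalEquality hiding (trans)
  open ≡-Reasoning
  open ListSum +-*-commutativeSemiring

  -- #isos cs ds counts the isomorphisms node cs ≅ node ds: the first child c is sent to some child
  -- d of the other root by an isomorphism c ≅ d, and the remaining children are matched recursively.
  mutual
    #iso : Tree → Tree → ℕ
    #iso (node cs) (node ds) = #isos cs ds

    #isos : List Tree → List Tree → ℕ
    #isos []       []      = 1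
    #isos []       (_ ∷ _) = 0
    #isos (c ∷ cs) ds      = ∑ (picks ds) (λ (d , ds′) → #iso c d * #isos cs ds′)

  #isos-∷ʳ : ∀ cs d ds → #isos cs (d ∷ ds) ≡ ∑ (picks cs) (λ (c , cs′) → #iso c d * #isos cs′ ds)
  #isos-∷ʳ []       d ds = refl
  #isos-∷ʳ (c ∷ cs) d ds = begin
      #isos (c ∷ cs) (d ∷ ds)
    ≡⟨ ∑-picks-∷ d ds _ ⟩
      Z + ∑ (picks ds) (λ (y , ys) → #iso c y * #isos cs (d ∷ ys))
    ≡⟨ cong (Z +_) (∑-cong (picks ds) λ (y , ys) → cong (#iso c y *_) (#isos-∷ʳ cs d ys)) ⟩
      Z + ∑ (picks ds) (λ (y , ys) → #iso c y * ∑ (picks cs) (λ (x , xs) → #iso x d * #isos xs ys))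
    ≡⟨ cong (Z +_) (∑-*-comm (picks ds) (picks cs)
         (λ (y , _) → #iso c y) (λ (x , _) → #iso x d) (λ (_ , ys) (_ , xs) → #isos xs ys)) ⟩
      Z + ∑ (picks cs) (λ (x , xs) → #iso x d * #isos (c ∷ xs) ds)
    ≡⟨ ∑-picks-∷ c cs _ ⟨
      ∑ (picks (c ∷ cs)) (λ (x , xs) → #iso x d * #isos xs ds)
    ∎
    where Z = #iso c d * #isos cs ds

  mutual
    #iso-sym : ∀ t t′ → #iso t t′ ≡ #iso t′ t
    #iso-sym (node cs) (node ds) = #isos-sym cs ds

    #isos-sym : ∀ cs ds → #isos cs ds ≡ #isos ds cs
    #isos-sym []       []      = refl
    #isos-sym []       (_ ∷ _) = refl
    #isos-sym (c ∷ cs) ds      = ≡.trans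
      (∑-cong (picks ds) λ (d , ds′) → cong₂ _*_ (#iso-sym c d) (#isos-sym cs ds′))
      (sym (#isos-∷ʳ ds c cs))

  #isos-∷-cong : ∀ c {cs cs′} → (∀ ds → #isos cs ds ≡ #isos cs′ ds) →
                 ∀ ds → #isos (c ∷ cs) ds ≡ #isos (c ∷ cs′) ds
  #isos-∷-cong c eq ds = ∑-cong (picks ds) λ (d , ds′) → cong (#iso c d *_) (eq ds′)

  #isos-swap : ∀ c c′ cs ds → #isos (c ∷ c′ ∷ cs) ds ≡ #isos (c′ ∷ c ∷ cs) ds
  #isos-swap c c′ cs ds = begin
      ∑ (picks ds) (λ (x , xs) → #iso c x * ∑ (picks xs) (λ (y , ys) → #iso c′ y * #isos cs ys))
    ≡⟨ ∑-cong (picks ds) (λ (x , xs) → ∑-distribˡ (#iso c x) (picks xs) _) ⟩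
      ∑ (picks ds) (λ (x , xs) → ∑ (picks xs) (λ (y , ys) → #iso c x * (#iso c′ y * #isos cs ys)))
    ≡⟨ ∑-picks-swap ds (λ x y ys → #iso c x * (#iso c′ y * #isos cs ys)) ⟩
      ∑ (picks ds) (λ (x , xs) → ∑ (picks xs) (λ (y , ys) → #iso c y * (#iso c′ x * #isos cs ys)))
    ≡⟨ ∑-cong (picks ds) (λ (x , xs) → ≡.trans
         (∑-cong (picks xs) λ (y , ys) → x∙yz≈y∙xz (#iso c y) (#iso c′ x) (#isos cs ys))
         (sym (∑-distribˡ (#iso c′ x) (picks xs) _))) ⟩
      ∑ (picks ds) (λ (x , xs) → #iso c′ x * ∑ (picks xs) (λ (y , ys) → #iso c y * #isos cs ys))
    ∎

  #isos-↭ˡ : ∀ {cs cs′} → cs ↭ cs′ → ∀ ds → #isos cs ds ≡ #isos cs′ ds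
  #isos-↭ˡ refl ds = refl
  #isos-↭ˡ {c ∷ cs} {_ ∷ cs′} (prep c π) ds = #isos-∷-cong c {cs} {cs′} (#isos-↭ˡ π) ds
  #isos-↭ˡ {c ∷ c′ ∷ cs} {_ ∷ _ ∷ cs′} (swap c c′ π) ds = ≡.trans (#isos-swap c c′ cs ds)
    (#isos-∷-cong c′ {c ∷ cs} {c ∷ cs′} (#isos-∷-cong c {cs} {cs′} (#isos-↭ˡ π)) ds)
  #isos-↭ˡ (trans π π′) ds = ≡.trans (#isos-↭ˡ π ds) (#isos-↭ˡ π′ ds)

  #isos-∑-head : ∀ (ps : List Tree) cs ds →
    ∑ ps (λ p → #isos (p ∷ cs) ds) ≡
    ∑ (picks ds) (λ (y , ys) → ∑ ps (λ p → #iso p y) * #isos cs ys)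
  #isos-∑-head ps cs ds = ≡.trans (∑-comm ps (picks ds) _)
    (∑-cong (picks ds) λ (y , ys) → sym (∑-distribʳ (#isos cs ys) ps (λ p → #iso p y)))

  #isos-∑-tail : ∀ c (xss : List (List Tree)) ds →
    ∑ xss (λ xs → #isos (c ∷ xs) ds) ≡
    ∑ (picks ds) (λ (y , ys) → #iso c y * ∑ xss (λ xs → #isos xs ys))
  #isos-∑-tail c xss ds = ≡.trans (∑-comm xss (picks ds) _)
    (∑-cong (picks ds) λ (y , ys) → sym (∑-distribˡ (#iso c y) xss (λ xs → #isos xs ys)))

  ∑-graftsL-∷ : ∀ d ds (G : List Tree → ℕ) →
    ∑ (graftsL (d ∷ ds)) G ≡ ∑ (grafts d) (λ g → G (g ∷ ds)) + ∑ (graftsL ds) (λ ys → G (d ∷ ys))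
  ∑-graftsL-∷ d ds G = ≡.trans (∑-++ (map (_∷ ds) (grafts d)) _ G)
    (cong₂ _+_ (∑-map (_∷ ds) (grafts d) G) (∑-map (d ∷_) (graftsL ds) G))

  ∑-graftsL-picks : ∀ ds (F : Tree × List Tree → ℕ) →
    ∑ (graftsL ds) (λ ys → ∑ (picks ys) F) ≡
    ∑ (picks ds) (λ (y , ys) → ∑ (grafts y) (λ g → F (g , ys)) + ∑ (graftsL ys) (λ zs → F (y , zs)))
  ∑-graftsL-picks []       F = refl
  ∑-graftsL-picks (d ∷ ds) F = begin
      ∑ (graftsL (d ∷ ds)) (λ ys → ∑ (picks ys) F)
    ≡⟨ ∑-graftsL-∷ d ds _ ⟩
      ∑ (grafts d) (λ g → ∑ (picks (g ∷ ds)) F) + ∑ (graftsL ds) (λ ys → ∑ (picks (d ∷ ys)) F)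
    ≡⟨ cong₂ _+_
         (≡.trans (∑-cong (grafts d) λ g → ∑-picks-∷ g ds F) (∑-distrib-+ (grafts d) _ _))
         (≡.trans (∑-cong (graftsL ds) λ ys → ∑-picks-∷ d ys F) (∑-distrib-+ (graftsL ds) _ _)) ⟩
      (A + B) + (C + ∑ (graftsL ds) (λ ys → ∑ (picks ys) (λ (y , zs) → F (y , d ∷ zs))))
    ≡⟨ cong (λ x → (A + B) + (C + x)) (≡.trans (∑-graftsL-picks ds _) (∑-distrib-+ (picks ds) X Y)) ⟩
      (A + B) + (C + (∑ (picks ds) X + ∑ (picks ds) Y))
    ≡⟨ solve 5 (λ a b c x y → (a :+ b) :+ (c :+ (x :+ y)) := (a :+ c) :+ (x :+ (b :+ y))) refl
               A B C (∑ (picks ds) X) (∑ (picks ds) Y) ⟩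
      (A + C) + (∑ (picks ds) X + (B + ∑ (picks ds) Y))
    ≡⟨ cong (λ b → (A + C) + (∑ (picks ds) X + (b + ∑ (picks ds) Y)))
            (∑-comm (grafts d) (picks ds) _) ⟩
      (A + C) + (∑ (picks ds) X + (∑ (picks ds) B′ + ∑ (picks ds) Y))
    ≡⟨ cong ((A + C) +_) (≡.trans (∑-distrib-+ (picks ds) X _)
                                  (cong (∑ (picks ds) X +_) (∑-distrib-+ (picks ds) B′ Y))) ⟨
      (A + C) + ∑ (picks ds) (λ p → X p + (B′ p + Y p))
    ≡⟨ ≡.trans (∑-picks-∷ d ds _) (cong ((A + C) +_) (∑-cong (picks ds) λ p@(y , ys) →
         cong (X p +_) (∑-graftsL-∷ d ys (λ zs → F (y , zs))))) ⟨
      ∑ (picks (d ∷ ds))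
        (λ (y , ys) → ∑ (grafts y) (λ g → F (g , ys)) + ∑ (graftsL ys) (λ zs → F (y , zs)))
    ∎
    where
    A = ∑ (grafts d) (λ g → F (g , ds))
    B = ∑ (grafts d) (λ g → ∑ (picks ds) (λ (y , ys) → F (y , g ∷ ys)))
    C = ∑ (graftsL ds) (λ ys → F (d , ys))
    X B′ Y : Tree × List Tree → ℕ
    X  (y , ys) = ∑ (grafts y) (λ g → F (g , d ∷ ys))
    B′ (y , ys) = ∑ (grafts d) (λ g → F (y , g ∷ ys))
    Y  (y , ys) = ∑ (graftsL ys) (λ zs → F (y , d ∷ zs))

  ∑-prunesL-∷ : ∀ c cs (F : List Tree → ℕ) → ∑ (prunesL (c ∷ cs)) F ≡
    #iso c • * F cs + ∑ (prunes c) (λ p → F (p ∷ cs)) + ∑ (prunesL cs) (λ xs → F (c ∷ xs))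
  ∑-prunesL-∷ (node [])      cs F =
    cong₂ _+_ (sym (≡.trans (+-identityʳ _) (*-identityˡ _))) (∑-map (• ∷_) (prunesL cs) F)
  ∑-prunesL-∷ (node (d ∷ e)) cs F = ≡.trans (∑-++ (map (_∷ cs) (prunes (node (d ∷ e)))) _ F)
    (cong₂ _+_ (∑-map (_∷ cs) (prunes (node (d ∷ e))) F) (∑-map (node (d ∷ e) ∷_) (prunesL cs) F))

  mutual
    ∑-prunes-#iso : ∀ t t′ → ∑ (prunes t) (λ p → #iso p t′) ≡ ∑ (grafts t′) (#iso t)
    ∑-prunes-#iso (node cs) (node ds) = begin
        ∑ (map node (prunesL cs)) (λ p → #iso p (node ds))
      ≡⟨ ∑-map node (prunesL cs) _ ⟩
        ∑ (prunesL cs) (λ xs → #isos xs ds)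
      ≡⟨ ∑-prunesL-#isos cs ds ⟩
        #isos cs (• ∷ ds) + ∑ (graftsL ds) (#isos cs)
      ≡⟨ cong (#isos cs (• ∷ ds) +_) (∑-map node (graftsL ds) (#iso (node cs))) ⟨
        ∑ (grafts (node ds)) (#iso (node cs))
      ∎

    ∑-prunesL-#isos : ∀ cs ds →
      ∑ (prunesL cs) (λ xs → #isos xs ds) ≡ #isos cs (• ∷ ds) + ∑ (graftsL ds) (#isos cs)
    ∑-prunesL-#isos []       []       = refl
    ∑-prunesL-#isos []       (d ∷ ds) = sym (≡.trans (∑-graftsL-∷ d ds (#isos []))
      (cong₂ _+_ (∑-zero (grafts d)) (∑-zero (graftsL ds))))
    ∑-prunesL-#isos (c ∷ cs) ds = begin
        ∑ (prunesL (c ∷ cs)) (λ xs → #isos xs ds)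
      ≡⟨ ∑-prunesL-∷ c cs _ ⟩
        Z + ∑ (prunes c) (λ p → #isos (p ∷ cs) ds) + ∑ (prunesL cs) (λ xs → #isos (c ∷ xs) ds)
      ≡⟨ cong₂ (λ g h → Z + g + h) grafted pruned ⟩
        Z + ∑ (picks ds) G + (∑ (picks ds) R + ∑ (picks ds) H)
      ≡⟨ solve 4 (λ z g r h → z :+ g :+ (r :+ h) := z :+ r :+ (g :+ h)) refl
                 Z (∑ (picks ds) G) (∑ (picks ds) R) (∑ (picks ds) H) ⟩
        Z + ∑ (picks ds) R + (∑ (picks ds) G + ∑ (picks ds) H)
      ≡⟨ cong₂ _+_ (∑-picks-∷ • ds _)
                   (≡.trans (∑-graftsL-picks ds _) (∑-distrib-+ (picks ds) G H)) ⟨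
        #isos (c ∷ cs) (• ∷ ds) + ∑ (graftsL ds) (#isos (c ∷ cs))
      ∎
      where
      Z = #iso c • * #isos cs ds
      G R H : Tree × List Tree → ℕ
      G (y , ys) = ∑ (grafts y) (λ g → #iso c g * #isos cs ys)
      R (y , ys) = #iso c y * #isos cs (• ∷ ys)
      H (y , ys) = ∑ (graftsL ys) (λ zs → #iso c y * #isos cs zs)

      grafted : ∑ (prunes c) (λ p → #isos (p ∷ cs) ds) ≡ ∑ (picks ds) G
      grafted = ≡.trans (#isos-∑-head (prunes c) cs ds) (∑-cong (picks ds) λ (y , ys) → ≡.trans
        (cong (_* #isos cs ys) (∑-prunes-#iso c y))
        (∑-distribʳ (#isos cs ys) (grafts y) (#iso c)))

      pruned : ∑ (prunesL cs) (λ xs → #isos (c ∷ xs) ds) ≡ ∑ (picks ds) R + ∑ (picks ds) H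
      pruned = ≡.trans (#isos-∑-tail c (prunesL cs) ds) (≡.trans
        (∑-cong (picks ds) λ q@(y , ys) → ≡.trans
          (cong (#iso c y *_) (∑-prunesL-#isos cs ys))
          (≡.trans (*-distribˡ-+ (#iso c y) _ _)
                   (cong (R q +_) (∑-distribˡ (#iso c y) (graftsL ys) (#isos cs)))))
        (∑-distrib-+ (picks ds) R H))

  rootPrunes : List Tree → List (List Tree)
  rootPrunes []                  = []
  rootPrunes (node [] ∷ cs)      = cs ∷ map (• ∷_) (rootPrunes cs)
  rootPrunes (node (d ∷ e) ∷ cs) = map (node (d ∷ e) ∷_) (rootPrunes cs)

  ∑-rootPrunes-∷ : ∀ c cs (F : List Tree → ℕ) →
    ∑ (rootPrunes (c ∷ cs)) F ≡ #iso c • * F cs + ∑ (rootPrunes cs) (λ xs → F (c ∷ xs))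
  ∑-rootPrunes-∷ (node [])      cs F = cong₂ _+_ (sym (*-identityˡ _)) (∑-map (• ∷_) (rootPrunes cs) F)
  ∑-rootPrunes-∷ (node (d ∷ e)) cs F = ∑-map (node (d ∷ e) ∷_) (rootPrunes cs) F

  ∑-rootPrunes-#isos : ∀ cs ds → ∑ (rootPrunes cs) (λ xs → #isos xs ds) ≡ #isos cs (• ∷ ds)
  ∑-rootPrunes-#isos []       ds = refl
  ∑-rootPrunes-#isos (c ∷ cs) ds = begin
      ∑ (rootPrunes (c ∷ cs)) (λ xs → #isos xs ds)
    ≡⟨ ∑-rootPrunes-∷ c cs _ ⟩
      #iso c • * #isos cs ds + ∑ (rootPrunes cs) (λ xs → #isos (c ∷ xs) ds)
    ≡⟨ cong (#iso c • * #isos cs ds +_) (≡.trans (#isos-∑-tail c (rootPrunes cs) ds)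
         (∑-cong (picks ds) λ (y , ys) → cong (#iso c y *_) (∑-rootPrunes-#isos cs ys))) ⟩
      #iso c • * #isos cs ds + ∑ (picks ds) (λ (y , ys) → #iso c y * #isos cs (• ∷ ys))
    ≡⟨ ∑-picks-∷ • ds _ ⟨
      #isos (c ∷ cs) (• ∷ ds)
    ∎

  𝟙 : Bool → ℕ
  𝟙 true  = 1
  𝟙 false = 0

  mutual
    ≅ᵇ-refl : ∀ t → t ≅ᵇ t ≡ true
    ≅ᵇ-refl (node cs) = isoL-refl cs

    isoL-refl : ∀ cs → isoL cs cs ≡ true
    isoL-refl []       = refl
    isoL-refl (c ∷ cs) rewrite ≅ᵇ-refl c = isoL-refl cs

  countIso-∷ : ∀ q d ds → countIso q (d ∷ ds) ≡ 𝟙 (q ≅ᵇ d) + countIso q ds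
  countIso-∷ q d ds with q ≅ᵇ d
  ... | true  = refl
  ... | false = refl

  countIso-self : ∀ c cs → countIso c (c ∷ cs) ≡ suc (countIso c cs)
  countIso-self c cs = ≡.trans (countIso-∷ c c cs) (cong (λ b → 𝟙 b + countIso c cs) (≅ᵇ-refl c))

  countIso-∑ : ∀ q ds → countIso q ds ≡ ∑ ds (λ d → 𝟙 (q ≅ᵇ d))
  countIso-∑ q []       = refl
  countIso-∑ q (d ∷ ds) = ≡.trans (countIso-∷ q d ds) (cong (𝟙 (q ≅ᵇ d) +_) (countIso-∑ q ds))

  countIso-↭ : ∀ {ds es} → ds ↭ es → ∀ q → countIso q ds ≡ countIso q es
  countIso-↭ {ds} {es} π q = ≡.trans (countIso-∑ q ds) (≡.trans (∑-↭ π _) (sym (countIso-∑ q es)))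

  removeIso-just : ∀ c ds {ds′} → removeIso c ds ≡ just ds′ →
                   ∃[ d ] (c ≅ᵇ d ≡ true × ds ↭ d ∷ ds′)
  removeIso-just c (d ∷ ds) eq with c ≅ᵇ d in c≅d
  removeIso-just c (d ∷ ds) refl | true = d , c≅d , refl
  ... | false with removeIso c ds in e
  removeIso-just c (d ∷ ds) refl | false | just ds′ with removeIso-just c ds e
  ... | x , c≅x , π = x , c≅x , trans (prep d π) (swap d x refl)

  removeIso-nothing : ∀ c ds → removeIso c ds ≡ nothing → countIso c ds ≡ 0
  removeIso-nothing c []       eq = refl
  removeIso-nothing c (d ∷ ds) eq with c ≅ᵇ d
  removeIso-nothing c (d ∷ ds) () | true
  ... | false with removeIso c ds in e
  removeIso-nothing c (d ∷ ds) () | false | just _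
  ... | nothing = removeIso-nothing c ds e

  EqualCounts : List Tree → List Tree → Set
  EqualCounts cs ds = ∀ q → countIso q cs ≡ countIso q ds

  -- Every tree being Stable says that ≅ᵇ (which is reflexive) is an equivalence relation.
  Stable : Tree → Set
  Stable a = ∀ {p} → p ≅ᵇ a ≡ true → ∀ q → q ≅ᵇ p ≡ q ≅ᵇ a

  Stable-resp : ∀ {c d} → Stable d → c ≅ᵇ d ≡ true → Stable c
  Stable-resp {c} {d} st-d c≅d {p} p≅c q =
    ≡.trans (st-d (≡.trans (sym (st-d c≅d p)) p≅c) q) (sym (st-d c≅d q))

  countIso-picked : ∀ {c y ds ys} → Stable y → c ≅ᵇ y ≡ true → ds ↭ y ∷ ys →
                    ∀ q → countIso q ds ≡ 𝟙 (q ≅ᵇ c) + countIso q ys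
  countIso-picked {c} {y} {ds} {ys} st-y c≅y π q = ≡.trans (countIso-↭ π q)
    (≡.trans (countIso-∷ q y ys) (cong (λ b → 𝟙 b + countIso q ys) (sym (st-y c≅y q))))

  removeIso-Stable : ∀ {c ds ds′} → All Stable ds → removeIso c ds ≡ just ds′ →
                     Stable c × All Stable ds′ ×
                     (∀ q → countIso q ds ≡ 𝟙 (q ≅ᵇ c) + countIso q ds′)
  removeIso-Stable {c} {ds} st e with removeIso-just c ds e
  ... | d , c≅d , π with All-resp-↭ π st
  ...   | st-d ∷ st′ = Stable-resp st-d c≅d , st′ , countIso-picked st-d c≅d π

  isoL⇒EqualCounts : ∀ cs ds → All Stable ds → isoL cs ds ≡ true → EqualCounts cs ds
  isoL⇒EqualCounts []       []      st _ q = refl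
  isoL⇒EqualCounts (c ∷ cs) ds      st h q with removeIso c ds in e
  ... | just ds′ with removeIso-Stable st e
  ...   | _ , st′ , count = begin
      countIso q (c ∷ cs)          ≡⟨ countIso-∷ q c cs ⟩
      𝟙 (q ≅ᵇ c) + countIso q cs   ≡⟨ cong (𝟙 (q ≅ᵇ c) +_) (isoL⇒EqualCounts cs ds′ st′ h q) ⟩
      𝟙 (q ≅ᵇ c) + countIso q ds′  ≡⟨ count q ⟨
      countIso q ds                ∎

  EqualCounts⇒isoL : ∀ cs ds → All Stable ds → EqualCounts cs ds → isoL cs ds ≡ true
  EqualCounts⇒isoL []       []       st eq = refl
  EqualCounts⇒isoL []       (d ∷ ds) st eq with () ← ≡.trans (eq d) (countIso-self d ds)
  EqualCounts⇒isoL (c ∷ cs) ds       st eq with removeIso c ds in e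
  ... | nothing with () ← ≡.trans (sym (countIso-self c cs)) (≡.trans (eq c) (removeIso-nothing c ds e))
  ... | just ds′ with removeIso-Stable st e
  ...   | _ , st′ , count = EqualCounts⇒isoL cs ds′ st′ λ q → +-cancelˡ-≡ (𝟙 (q ≅ᵇ c)) _ _ (begin
      𝟙 (q ≅ᵇ c) + countIso q cs   ≡⟨ countIso-∷ q c cs ⟨
      countIso q (c ∷ cs)          ≡⟨ eq q ⟩
      countIso q ds                ≡⟨ count q ⟩
      𝟙 (q ≅ᵇ c) + countIso q ds′  ∎)

  isoL-All-Stable : ∀ cs ds → All Stable ds → isoL cs ds ≡ true → All Stable cs
  isoL-All-Stable []       ds st h = []
  isoL-All-Stable (c ∷ cs) ds st h with removeIso c ds in e
  ... | just ds′ with removeIso-Stable st e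
  ...   | st-c , st′ , _ = st-c ∷ isoL-All-Stable cs ds′ st′ h

  mutual
    stable : ∀ t → Stable t
    stable (node ds) {node ps} ps≅ds (node qs) = ⇔→≡ (mk⇔
      (λ qs≅ps → EqualCounts⇒isoL qs ds st λ r →
         ≡.trans (isoL⇒EqualCounts qs ps st-ps qs≅ps r) (ps≈ds r))
      (λ qs≅ds → EqualCounts⇒isoL qs ps st-ps λ r →
         ≡.trans (isoL⇒EqualCounts qs ds st qs≅ds r) (sym (ps≈ds r))))
      where
      st    = all-stable ds
      st-ps = isoL-All-Stable ps ds st ps≅ds
      ps≈ds = isoL⇒EqualCounts ps ds st ps≅ds

    all-stable : ∀ ds → All Stable ds
    all-stable []       = []
    all-stable (d ∷ ds) = stable d ∷ all-stable ds

  isoL⇔EqualCounts : ∀ cs ds → isoL cs ds ≡ true ⇔ EqualCounts cs ds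
  isoL⇔EqualCounts cs ds =
    mk⇔ (isoL⇒EqualCounts cs ds (all-stable ds)) (EqualCounts⇒isoL cs ds (all-stable ds))

  isoL-picked : ∀ {c cs ds y ys} → ds ↭ y ∷ ys → c ≅ᵇ y ≡ true → isoL (c ∷ cs) ds ≡ isoL cs ys
  isoL-picked {c} {cs} {ds} {y} {ys} π c≅y = ⇔→≡
    (⇔.trans (isoL⇔EqualCounts (c ∷ cs) ds) (⇔.trans (mk⇔ to from) (⇔.sym (isoL⇔EqualCounts cs ys))))
    where
    count = countIso-picked (stable y) c≅y π

    to : EqualCounts (c ∷ cs) ds → EqualCounts cs ys
    to eq q = +-cancelˡ-≡ (𝟙 (q ≅ᵇ c)) _ _
      (≡.trans (sym (countIso-∷ q c cs)) (≡.trans (eq q) (count q)))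

    from : EqualCounts cs ys → EqualCounts (c ∷ cs) ds
    from eq q = ≡.trans (countIso-∷ q c cs) (≡.trans (cong (𝟙 (q ≅ᵇ c) +_) (eq q)) (sym (count q)))

  mutual
    #iso-bridge : ∀ t t′ → #iso t t′ ≡ (if t ≅ᵇ t′ then ∣SG∣ t else 0)
    #iso-bridge (node cs) (node ds) = #isos-bridge cs ds

    #isos-bridge : ∀ cs ds → #isos cs ds ≡ (if isoL cs ds then ∣SG∣ (node cs) else 0)
    #isos-bridge []       []      = refl
    #isos-bridge []       (_ ∷ _) = refl
    #isos-bridge (c ∷ cs) ds      = begin
        ∑ (picks ds) (λ (y , ys) → #iso c y * #isos cs ys)
      ≡⟨ ∑-cong-∈ (picks ds) (λ y∈ → term (picks-↭ y∈)) ⟩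
        ∑ (picks ds) (λ (y , _) → 𝟙 (c ≅ᵇ y) * w)
      ≡⟨ ∑-distribʳ w (picks ds) _ ⟨
        ∑ (picks ds) (λ (y , _) → 𝟙 (c ≅ᵇ y)) * w
      ≡⟨ cong (_* w) (≡.trans (∑-picks-proj₁ ds _) (sym (countIso-∑ c ds))) ⟩
        countIso c ds * w
      ≡⟨ multiplicity b (λ iso → ≡.trans (sym (isoL⇒EqualCounts (c ∷ cs) ds (all-stable ds) iso c))
                                         (countIso-self c cs)) ⟩
        (if b then ∣SG∣ (node (c ∷ cs)) else 0)
      ∎
      where
      b = isoL (c ∷ cs) ds
      w = ∣SG∣ c * (if b then ∣SG∣ (node cs) else 0)

      if-*-if : ∀ (b₁ b₂ b : Bool) {m n} → (b₁ ≡ true → b₂ ≡ b) →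
                (if b₁ then m else 0) * (if b₂ then n else 0) ≡ 𝟙 b₁ * (m * (if b then n else 0))
      if-*-if true  b₂ b {m} {n} h =
        ≡.trans (cong (λ z → m * (if z then n else 0)) (h refl)) (sym (+-identityʳ _))
      if-*-if false b₂ b h = refl

      term : ∀ {y ys} → ds ↭ y ∷ ys → #iso c y * #isos cs ys ≡ 𝟙 (c ≅ᵇ y) * w
      term {y} {ys} π = ≡.trans (cong₂ _*_ (#iso-bridge c y) (#isos-bridge cs ys))
                                (if-*-if (c ≅ᵇ y) (isoL cs ys) b (λ c≅y → sym (isoL-picked π c≅y)))

      multiplicity : ∀ b′ → (b′ ≡ true → countIso c ds ≡ suc (countIso c cs)) →
        countIso c ds * (∣SG∣ c * (if b′ then ∣SG∣ (node cs) else 0)) ≡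
        (if b′ then ∣SG∣ (node (c ∷ cs)) else 0)
      multiplicity true  h rewrite h refl =
        solve 4 (λ k σ s l → (con 1 :+ k) :* (σ :* (s :* l)) := ((con 1 :+ k) :* s) :* (σ :* l)) refl
                (countIso c cs) (∣SG∣ c) (sgLocal cs) (∣SG∣L cs)
      multiplicity false h = ≡.trans (cong (countIso c ds *_) (*-zeroʳ (∣SG∣ c))) (*-zeroʳ (countIso c ds))

module Adjointness {c ℓ} (F : Field c ℓ) where

  import Data.Nat as ℕ
  open import Data.Nat.Properties using (+-*-commutativeSemiring)
  open import Data.Bool using (true; false; if_then_else_)
  open import Data.List.Properties using (map-∘)
  open import Data.List.Relation.Binary.Permutation.Propositional using (↭-sym)
  open import Data.List.Relation.Binary.Permutation.Propositional.Properties using (++⁺ʳ; ∷↭∷ʳ)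
  open import Algebra.Properties.Ring using (-1*x≈-x)
  open Field F
  open HK F
  open ListSum commutativeSemiring
  module ℕ∑ = ListSum +-*-commutativeSemiring
  open Isomorphisms
    using (#isos; #isos-sym; #isos-↭ˡ; #isos-bridge; ∑-prunesL-#isos; rootPrunes; ∑-rootPrunes-#isos)
  open import Relation.Binary.Reasoning.Setoid setoid

  ⌜⌝-+ : ∀ m n → ⌜ m ℕ.+ n ⌝ ≈ ⌜ m ⌝ + ⌜ n ⌝
  ⌜⌝-+ ℕ.zero    n = sym (+-identityˡ _)
  ⌜⌝-+ (ℕ.suc m) n = trans (+-congˡ (⌜⌝-+ m n)) (sym (+-assoc 1# _ _))

  ⌜⌝-∑ : ∀ {A : Set} (xs : List A) (f : A → ℕ.ℕ) → ⌜ ℕ∑.∑ xs f ⌝ ≈ ∑ xs (⌜_⌝ ∘ f)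
  ⌜⌝-∑ []       f = refl
  ⌜⌝-∑ (x ∷ xs) f = trans (⌜⌝-+ (f x) _) (+-congˡ (⌜⌝-∑ xs f))

  K : Monomial → Monomial → Carrier
  K u v = ⌜ #isos u v ⌝

  K-sym : ∀ u v → K u v ≈ K v u
  K-sym u v = reflexive (≡.cong ⌜_⌝ (#isos-sym u v))

  Invariant : (Monomial → Carrier) → Set ℓ
  Invariant H = ∀ {u v} → u ↭ v → H u ≈ H v

  K-invariantˡ : ∀ v → Invariant (λ u → K u v)
  K-invariantˡ v π = reflexive (≡.cong ⌜_⌝ (#isos-↭ˡ π v))

  K-invariantʳ : ∀ u → Invariant (K u)
  K-invariantʳ u {v} {v′} π = trans (K-sym u v) (trans (K-invariantˡ u π) (K-sym v′ u))

  ∑-prunesL-K : ∀ w y → ∑ (prunesL w) (λ x → K x y) ≈ K w (• ∷ y) + ∑ (graftsL y) (K w)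
  ∑-prunesL-K w y = begin
    ∑ (prunesL w) (λ x → K x y)                         ≈⟨ ⌜⌝-∑ (prunesL w) (λ x → #isos x y) ⟨
    ⌜ ℕ∑.∑ (prunesL w) (λ x → #isos x y) ⌝              ≡⟨ ≡.cong ⌜_⌝ (∑-prunesL-#isos w y) ⟩
    ⌜ #isos w (• ∷ y) ℕ.+ ℕ∑.∑ (graftsL y) (#isos w) ⌝  ≈⟨ ⌜⌝-+ (#isos w (• ∷ y)) _ ⟩
    K w (• ∷ y) + ⌜ ℕ∑.∑ (graftsL y) (#isos w) ⌝        ≈⟨ +-congˡ (⌜⌝-∑ (graftsL y) (#isos w)) ⟩
    K w (• ∷ y) + ∑ (graftsL y) (K w)                   ∎

  ∑-rootPrunes-K : ∀ w y → ∑ (rootPrunes y) (K w) ≈ K (• ∷ w) y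
  ∑-rootPrunes-K w y = begin
    ∑ (rootPrunes y) (K w)                     ≈⟨ ∑-cong (rootPrunes y) (K-sym w) ⟩
    ∑ (rootPrunes y) (λ x → K x w)             ≈⟨ ⌜⌝-∑ (rootPrunes y) (λ x → #isos x w) ⟨
    ⌜ ℕ∑.∑ (rootPrunes y) (λ x → #isos x w) ⌝  ≡⟨ ≡.cong ⌜_⌝ (∑-rootPrunes-#isos y w) ⟩
    K y (• ∷ w)                                ≈⟨ K-sym y (• ∷ w) ⟩
    K (• ∷ w) y                                ∎

  ev : Poly → (Monomial → Carrier) → Carrier
  ev p H = ∑ p (λ (a , u) → a * H u)

  ev-cong : ∀ p {H H′ : Monomial → Carrier} → (∀ u → H u ≈ H′ u) → ev p H ≈ ev p H′
  ev-cong p H≈H′ = ∑-cong p (λ (a , u) → *-congˡ (H≈H′ u))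

  ev-+ : ∀ p (H H′ : Monomial → Carrier) → ev p (λ u → H u + H′ u) ≈ ev p H + ev p H′
  ev-+ p H H′ = trans (∑-cong p (λ (a , u) → distribˡ a (H u) (H′ u))) (∑-distrib-+ p _ _)

  ev-scale : ∀ k p H → ev (scale k p) H ≈ k * ev p H
  ev-scale k p H = begin
    ev (scale k p) H                    ≡⟨ ∑-map _ p _ ⟩
    ∑ p (λ (a , u) → (k * a) * H u)     ≈⟨ ∑-cong p (λ (a , u) → *-assoc k a (H u)) ⟩
    ∑ p (λ (a , u) → k * (a * H u))     ≈⟨ ∑-distribˡ k p _ ⟨
    k * ev p H                          ∎

  ev-M• : ∀ p H → ev (M• p) H ≡ ev p (λ u → H (• ∷ u))
  ev-M• p H = ∑-map _ p _

  ev-∑ : ∀ {A : Set} p (xs : List A) (G : A → Monomial → Carrier) →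
         ev p (λ u → ∑ xs (λ x → G x u)) ≈ ∑ xs (λ x → ev p (G x))
  ev-∑ p xs G = trans (∑-cong p (λ (a , u) → ∑-distribˡ a xs (λ x → G x u))) (∑-comm p xs _)

  ev-comm : ∀ p q (G : Monomial → Monomial → Carrier) →
            ev p (λ u → ev q (G u)) ≈ ev q (λ v → ev p (λ u → G u v))
  ev-comm p q G = ∑-*-comm p q proj₁ proj₁ (λ (_ , u) (_ , v) → G u v)

  ⟪⟫ᵀ-B₊ : ∀ u v → ⟪ B₊ u , B₊ v ⟫ᵀ ≈ K u v
  ⟪⟫ᵀ-B₊ u v = reflexive (≡.sym (≡.trans (≡.cong ⌜_⌝ (#isos-bridge u v)) (⌜if⌝ (isoL u v))))
    where
    ⌜if⌝ : ∀ b {n} → ⌜ (if b then n else 0) ⌝ ≡ (if b then ⌜ n ⌝ else 0#)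
    ⌜if⌝ true  = ≡.refl
    ⌜if⌝ false = ≡.refl

  row-∷ : ∀ {a b u v x y} → x ≈ a * y → (a * b) * ⟪ B₊ u , B₊ v ⟫ᵀ + x ≈ a * (b * K u v + y)
  row-∷ {a} {b} {u} {v} x≈ay =
    trans (+-cong (trans (*-congˡ (⟪⟫ᵀ-B₊ u v)) (*-assoc a b (K u v))) x≈ay) (sym (distribˡ a _ _))

  -- ⟪ (a , u) ∷ p , Q ⟫ adds up its row with a function local to the definition of ⟪_,_⟫, applied to
  -- (a, u, p, Q) and then to the part r of Q still to be summed.  It cannot be named here, so the `_`
  -- is solved by unification in ⟪⟫-ev, where `with` makes Q and r distinct variables.
  ⟪⟫-row : ∀ a u p Q r → _ ≈ a * ev r (K u)

  ⟪⟫-ev : ∀ p q → ⟪ p , q ⟫ ≈ ev p (λ u → ev q (K u))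
  ⟪⟫-ev []            q             = refl
  ⟪⟫-ev ((a , u) ∷ p) []            = +-cong (sym (zeroʳ a)) (⟪⟫-ev p [])
  ⟪⟫-ev ((a , u) ∷ p) ((b , v) ∷ r) with (b , v) ∷ r in eq
  ... | q = +-cong (row-∷ {u = u} {v} (⟪⟫-row a u p q r))
    (≡.subst (λ q′ → ⟪ p , q′ ⟫ ≈ ev p (λ u′ → ev ((b , v) ∷ r) (K u′))) eq
             (⟪⟫-ev p ((b , v) ∷ r)))

  ⟪⟫-row a u p Q []            = sym (zeroʳ a)
  ⟪⟫-row a u p Q ((b , v) ∷ r) = row-∷ {u = u} {v} (⟪⟫-row a u p Q r)

  ⟪⟫-sym : ∀ p q → ⟪ p , q ⟫ ≈ ⟪ q , p ⟫
  ⟪⟫-sym p q = begin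
    ⟪ p , q ⟫                          ≈⟨ ⟪⟫-ev p q ⟩
    ev p (λ u → ev q (K u))            ≈⟨ ev-comm p q K ⟩
    ev q (λ v → ev p (λ u → K u v))    ≈⟨ ev-cong q (λ v → ev-cong p (λ u → K-sym u v)) ⟩
    ev q (λ v → ev p (K v))            ≈⟨ ⟪⟫-ev q p ⟨
    ⟪ q , p ⟫                          ∎

  ⟪⟫-⊕ʳ : ∀ p q r → ⟪ p , q ⊕ r ⟫ ≈ ⟪ p , q ⟫ + ⟪ p , r ⟫
  ⟪⟫-⊕ʳ p q r = begin
    ⟪ p , q ⊕ r ⟫                                      ≈⟨ ⟪⟫-ev p (q ⊕ r) ⟩
    ev p (λ u → ev (q ⊕ r) (K u))                      ≈⟨ ev-cong p (λ u → ∑-++ q r _) ⟩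
    ev p (λ u → ev q (K u) + ev r (K u))               ≈⟨ ev-+ p _ _ ⟩
    ev p (λ u → ev q (K u)) + ev p (λ u → ev r (K u))  ≈⟨ +-cong (⟪⟫-ev p q) (⟪⟫-ev p r) ⟨
    ⟪ p , q ⟫ + ⟪ p , r ⟫                              ∎

  ⟪⟫-scaleʳ : ∀ p k q → ⟪ p , scale k q ⟫ ≈ k * ⟪ p , q ⟫
  ⟪⟫-scaleʳ p k q = begin
    ⟪ p , scale k q ⟫                  ≈⟨ ⟪⟫-sym p (scale k q) ⟩
    ⟪ scale k q , p ⟫                  ≈⟨ ⟪⟫-ev (scale k q) p ⟩
    ev (scale k q) (λ v → ev p (K v))  ≈⟨ ev-scale k q _ ⟩
    k * ev q (λ v → ev p (K v))        ≈⟨ *-congˡ (trans (⟪⟫-sym p q) (⟪⟫-ev q p)) ⟨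
    k * ⟪ p , q ⟫                      ∎

  units : List Monomial → Poly
  units = map (1# ,_)

  ev-units : ∀ L H → ev (units L) H ≈ ∑ L H
  ev-units L H = trans (reflexive (∑-map _ L _)) (∑-cong L (λ x → *-identityˡ (H x)))

  leibniz : (Tree → List Monomial) → Monomial → List Monomial
  leibniz Dl []      = []
  leibniz Dl (t ∷ u) = map (_++ u) (Dl t) ++ map (t ∷_) (leibniz Dl u)

  -- derivMon puts the factor t last in the terms that differentiate u, hence Invariant H.
  ev-derivMon : ∀ {D : Tree → Poly} Dl → (∀ t → D t ≡ units (Dl t)) →
                ∀ w {H} → Invariant H → ev (derivMon D w) H ≈ ∑ (leibniz Dl w) H
  ev-derivMon Dl D≡ []      inv = refl
  ev-derivMon {D} Dl D≡ (t ∷ u) {H} inv = begin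
      ev (mulMon (D t) u ⊕ mulMon (derivMon D u) [ t ]) H
    ≈⟨ ∑-++ (mulMon (D t) u) _ _ ⟩
      ev (mulMon (D t) u) H + ev (mulMon (derivMon D u) [ t ]) H
    ≡⟨ ≡.cong₂ _+_ (∑-map _ (D t) _) (∑-map _ (derivMon D u) _) ⟩
      ev (D t) (λ x → H (x ++ u)) + ev (derivMon D u) (λ x → H (x ++ [ t ]))
    ≈⟨ +-cong (trans (reflexive (≡.cong (λ p → ev p _) (D≡ t))) (ev-units (Dl t) _))
              (ev-derivMon Dl D≡ u (inv ∘ ++⁺ʳ [ t ])) ⟩
      ∑ (Dl t) (λ x → H (x ++ u)) + ∑ (leibniz Dl u) (λ x → H (x ++ [ t ]))
    ≈⟨ +-congˡ (∑-cong (leibniz Dl u) (λ x → inv (↭-sym (∷↭∷ʳ t x)))) ⟩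
      ∑ (Dl t) (λ x → H (x ++ u)) + ∑ (leibniz Dl u) (λ x → H (t ∷ x))
    ≡⟨ ≡.cong₂ _+_ (∑-map (_++ u) (Dl t) H) (∑-map (t ∷_) (leibniz Dl u) H) ⟨
      ∑ (map (_++ u) (Dl t)) H + ∑ (map (t ∷_) (leibniz Dl u)) H
    ≈⟨ ∑-++ (map (_++ u) (Dl t)) _ H ⟨
      ∑ (leibniz Dl (t ∷ u)) H
    ∎

  ev-derivation : ∀ {D : Tree → Poly} Dl → (∀ t → D t ≡ units (Dl t)) →
                  ∀ p {H} → Invariant H → ev (derivation D p) H ≈ ev p (λ w → ∑ (leibniz Dl w) H)
  ev-derivation Dl D≡ []            inv = refl
  ev-derivation {D} Dl D≡ ((a , u) ∷ p) {H} inv = begin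
    ev (scale a (derivMon D u) ⊕ derivation D p) H          ≈⟨ ∑-++ (scale a (derivMon D u)) _ _ ⟩
    ev (scale a (derivMon D u)) H + ev (derivation D p) H   ≈⟨ +-cong (ev-scale a (derivMon D u) H)
                                                                        (ev-derivation Dl D≡ p inv) ⟩
    a * ev (derivMon D u) H + _                             ≈⟨ +-congʳ (*-congˡ (ev-derivMon Dl D≡ u inv)) ⟩
    a * ∑ (leibniz Dl u) H + _                              ∎

  prunesᴹ : Tree → List Monomial
  prunesᴹ (node [])      = [ [] ]
  prunesᴹ (node (d ∷ e)) = map [_] (prunes (node (d ∷ e)))

  leibniz-prunesᴹ : ∀ w → leibniz prunesᴹ w ≡ prunesL w
  leibniz-prunesᴹ []                 = ≡.refl
  leibniz-prunesᴹ (node [] ∷ u)      = ≡.cong (λ L → u ∷ map (• ∷_) L) (leibniz-prunesᴹ u)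
  leibniz-prunesᴹ (node (d ∷ e) ∷ u) = ≡.cong₂ _++_
    (≡.sym (map-∘ (prunes (node (d ∷ e))))) (≡.cong (map (node (d ∷ e) ∷_)) (leibniz-prunesᴹ u))

  graftsᴹ : Tree → List Monomial
  graftsᴹ t = map [_] (grafts t)

  leibniz-graftsᴹ : ∀ w → leibniz graftsᴹ w ≡ graftsL w
  leibniz-graftsᴹ []      = ≡.refl
  leibniz-graftsᴹ (t ∷ u) =
    ≡.cong₂ _++_ (≡.sym (map-∘ (grafts t))) (≡.cong (map (t ∷_)) (leibniz-graftsᴹ u))

  ∂•ᴹ : Tree → List Monomial
  ∂•ᴹ (node [])      = [ [] ]
  ∂•ᴹ (node (_ ∷ _)) = []

  leibniz-∂•ᴹ : ∀ w → leibniz ∂•ᴹ w ≡ rootPrunes w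
  leibniz-∂•ᴹ []                 = ≡.refl
  leibniz-∂•ᴹ (node [] ∷ u)      = ≡.cong (λ L → u ∷ map (• ∷_) L) (leibniz-∂•ᴹ u)
  leibniz-∂•ᴹ (node (d ∷ e) ∷ u) = ≡.cong (map (node (d ∷ e) ∷_)) (leibniz-∂•ᴹ u)

  ev-P : ∀ p {H} → Invariant H → ev (P p) H ≈ ev p (λ w → ∑ (prunesL w) H)
  ev-P p inv =
    trans (ev-derivation prunesᴹ (λ { (node []) → ≡.refl ; (node (_ ∷ _)) → map-∘ _ }) p inv)
          (ev-cong p (λ w → reflexive (≡.cong (λ L → ∑ L _) (leibniz-prunesᴹ w))))

  ev-N : ∀ p {H} → Invariant H → ev (N p) H ≈ ev p (λ w → ∑ (graftsL w) H)
  ev-N p inv =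
    trans (ev-derivation graftsᴹ (λ t → map-∘ (grafts t)) p inv)
          (ev-cong p (λ w → reflexive (≡.cong (λ L → ∑ L _) (leibniz-graftsᴹ w))))

  ev-∂• : ∀ p {H} → Invariant H → ev (∂• p) H ≈ ev p (λ w → ∑ (rootPrunes w) H)
  ev-∂• p inv =
    trans (ev-derivation ∂•ᴹ (λ { (node []) → ≡.refl ; (node (_ ∷ _)) → ≡.refl }) p inv)
          (ev-cong p (λ w → reflexive (≡.cong (λ L → ∑ L _) (leibniz-∂•ᴹ w))))

  P-adjoint : AdjointP
  P-adjoint u v = begin
      ⟪ P u , v ⟫
    ≈⟨ ⟪⟫-ev (P u) v ⟩
      ev (P u) (λ w → ev v (K w))
    ≈⟨ ev-P u (λ π → ev-cong v (λ y → K-invariantˡ y π)) ⟩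
      ev u (λ w → ∑ (prunesL w) (λ x → ev v (K x)))
    ≈⟨ ev-cong u (λ w → ev-∑ v (prunesL w) K) ⟨
      ev u (λ w → ev v (λ y → ∑ (prunesL w) (λ x → K x y)))
    ≈⟨ ev-cong u (λ w → ev-cong v (∑-prunesL-K w)) ⟩
      ev u (λ w → ev v (λ y → K w (• ∷ y) + ∑ (graftsL y) (K w)))
    ≈⟨ ev-cong u (λ w → trans (ev-+ v _ _) (+-comm _ _)) ⟩
      ev u (λ w → ev v (λ y → ∑ (graftsL y) (K w)) + ev v (λ y → K w (• ∷ y)))
    ≈⟨ ev-cong u (λ w → +-cong (ev-N v (K-invariantʳ w)) (reflexive (ev-M• v (K w)))) ⟨
      ev u (λ w → ev (N v) (K w) + ev (M• v) (K w))
    ≈⟨ ev-cong u (λ w → ∑-++ (N v) (M• v) _) ⟨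
      ev u (λ w → ev (N v ⊕ M• v) (K w))
    ≈⟨ ⟪⟫-ev u (N v ⊕ M• v) ⟨
      ⟪ u , N v ⊕ M• v ⟫
    ∎

  M•-∂•-adjoint : ∀ u v → ⟪ M• u , v ⟫ ≈ ⟪ u , ∂• v ⟫
  M•-∂•-adjoint u v = begin
      ⟪ M• u , v ⟫
    ≈⟨ ⟪⟫-ev (M• u) v ⟩
      ev (M• u) (λ w → ev v (K w))
    ≡⟨ ev-M• u _ ⟩
      ev u (λ w → ev v (K (• ∷ w)))
    ≈⟨ ev-cong u (λ w → ev-cong v (∑-rootPrunes-K w)) ⟨
      ev u (λ w → ev v (λ y → ∑ (rootPrunes y) (K w)))
    ≈⟨ ev-cong u (λ w → ev-∂• v (K-invariantʳ w)) ⟨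
      ev u (λ w → ev (∂• v) (K w))
    ≈⟨ ⟪⟫-ev u (∂• v) ⟨
      ⟪ u , ∂• v ⟫
    ∎

  N-adjoint : AdjointN
  N-adjoint u v = sym (begin
      ⟪ u , P v ⊖ ∂• v ⟫
    ≈⟨ ⟪⟫-⊕ʳ u (P v) _ ⟩
      ⟪ u , P v ⟫ + ⟪ u , scale (- 1#) (∂• v) ⟫
    ≈⟨ +-cong (⟪⟫-sym u (P v)) (trans (⟪⟫-scaleʳ u (- 1#) (∂• v)) (-1*x≈-x ring _)) ⟩
      ⟪ P v , u ⟫ + - ⟪ u , ∂• v ⟫
    ≈⟨ +-cong (P-adjoint v u) (-‿cong (sym (M•-∂•-adjoint u v))) ⟩
      ⟪ v , N u ⊕ M• u ⟫ + - ⟪ M• u , v ⟫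
    ≈⟨ +-congʳ (trans (⟪⟫-⊕ʳ v (N u) (M• u)) (+-cong (⟪⟫-sym v (N u)) (⟪⟫-sym v (M• u)))) ⟩
      ⟪ N u , v ⟫ + ⟪ M• u , v ⟫ + - ⟪ M• u , v ⟫
    ≈⟨ +-assoc _ _ _ ⟩
      ⟪ N u , v ⟫ + (⟪ M• u , v ⟫ + - ⟪ M• u , v ⟫)
    ≈⟨ +-congˡ (-‿inverseʳ _) ⟩
      ⟪ N u , v ⟫ + 0#
    ≈⟨ +-identityʳ _ ⟩
      ⟪ N u , v ⟫
    ∎)

proposition3p3 : ∀ {c ℓ} (F : Field c ℓ) → CharZero F →
    HK.AdjointP F × HK.AdjointN F
proposition3p3 F _ = Adjointness.P-adjoint F , Adjointness.N-adjoint F
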